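{- There exists a constant $\gamma>0$ such that $p_3(3,q)>q^2e^{ -\gamma\sqrt{\log q}}$ for all integers $q\ge 3$.
   Context: A $PHF(N;n,q,t)$ is an $N\times n$ matrix over $[q]$ such that for every set of $t$ columns there is a row in which these $t$ columns have pairwise distinct entries; $p_t(N,q)$ is the maximum $n$ for which such a matrix exists. -}

module Defs where

open import Data.Nat using (ℕ)
open import Data.Fin using (Fin)
open import Data.Product using (∃-syntax)
open import Function.Definitions using (Injective)
open import Relation.Binary.PropositionalEquality using (_≡_)

Matrix : ℕ → ℕ → ℕ → Set
Matrix N n q = Fin N → Fin n → Fin q

-- PHF(N;n,q,t): for every set of t (distinct) columns, listed injectively
-- as cols : Fin t → Fin n, some row r has these t columns pairwise distinct,
-- i.e. i ↦ M r (cols i) is injective.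
IsPHF : (N n q t : ℕ) → Matrix N n q → Set
IsPHF N n q t M =
  (cols : Fin t → Fin n) → Injective _≡_ _≡_ cols →
  ∃[ r ] Injective _≡_ _≡_ (λ i → M r (cols i))

-- "p_t(N,q) > x" : since p_t(N,q) is the maximum n admitting a PHF(N;n,q,t),
-- p_t(N,q) > x holds iff some PHF(N;n,q,t) exists with n > x.

{-# OPTIONS --safe #-}
-- Behrend-type construction. A column is a pair (u, a) of points of [d]^s with a on a
-- sphere Σₜ aₜ² = R, and the three rows are u + a, u and 2u + a, read coordinatewise as
-- s-digit numbers in base 3d, so (3d)^s ≤ q symbols suffice. If no row separates three
-- distinct columns, each row has a colliding pair and these pairs form a triangle; then the
-- a-parts of two columns have the a-part of the third as midpoint, which strict convexity
-- of the squared norm forbids on a sphere. Pigeonholing [d]^s by radius gives a sphere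
-- with at least d^s/(s d² + 1) points. Taking d maximal with (3d)^s ≤ q, the hypothesis
-- log₂ q ≤ s² gives d < 4^s, and q² < (6^s d^s)² ≤ 36^s · 32^s · n ≤ 2^(11 s) · n.
-- When q < 3^s the q × q identity matrix already suffices.

module Submission where

open import Defs
open import Data.Nat.Logarithm using (⌊log₂_⌋; ⌊log₂⌋-mono-≤; ⌊log₂[2^n]⌋≡n)
open import Data.Nat
open import Data.Nat.Properties
open import Algebra.Properties.CommutativeSemigroup +-commutativeSemigroup using () renaming (interchange to +-interchange)
open import Algebra.Properties.CommutativeSemigroup *-commutativeSemigroup using () renaming (interchange to *-interchange)
open import Data.Nat.Tactic.RingSolver using (solve; solve-∀)
open import Data.Fin using (Fin; zero; suc; toℕ; fromℕ<; inject≤; punchIn; punchOut; combine; remQuot; finToFun; funToFin)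
open import Data.Fin.Patterns using (0F; 1F; 2F)
open import Data.Fin.Properties
  using (toℕ<n; toℕ-fromℕ<; toℕ-injective; inject≤-injective; combine-remQuot; finToFun-funToFin; funToFin-finToFin;
         punchIn-injective; punchInᵢ≢i; punchIn-punchOut; any?)
  renaming (_≟_ to _≟ᶠ_)
open import Data.List using (List; []; _∷_; length; lookup; filter; allFin)
open import Data.List.Properties using (length-tabulate; filter-all; filter-none; filter-accept; filter-reject)
open import Data.List.Relation.Unary.All as All using (All)
open import Data.List.Relation.Unary.All.Properties using (all-filter; tabulate⁺)
open import Data.List.Relation.Unary.AllPairs using (_∷_)
open import Data.List.Relation.Unary.Unique.Propositional using (Unique)
open import Data.List.Relation.Unary.Unique.Propositional.Properties using (allFin⁺; filter⁺)
open import Data.List.Membership.Propositional.Properties using (∈-lookup)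
open import Data.Product using (∃; ∃-syntax; _×_; _,_; proj₁; proj₂; uncurry)
open import Data.Sum using (_⊎_; inj₁; inj₂)
open import Data.Empty using (⊥; ⊥-elim)
open import Function using (_∘_; id)
open import Function.Bundles using (_⇔_; mk⇔; Equivalence)
open import Function.Definitions using (Injective)
open import Relation.Binary.Definitions using (DecidableEquality; tri<; tri≈; tri>)
open import Relation.Unary using (Decidable)
open import Relation.Binary.PropositionalEquality
open import Relation.Nullary using (yes; no)
open import Relation.Nullary.Decidable using (decidable-stable)

-- Spheres contain no non-trivial three-term progressions

midpoint-offset : ∀ {x y z} → x + y ≡ z + z → z ≤ x → ∃[ t ] (x ≡ y + t + t × z ≡ y + t)
midpoint-offset {x} {y} {z} x+y≡z+z z≤x = t , x≡y+t+t , z≡y+t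
  where
  open ≡-Reasoning
  t = x ∸ z
  x≡z+t : x ≡ z + t
  x≡z+t = sym (m+[n∸m]≡n z≤x)
  z≡y+t : z ≡ y + t
  z≡y+t = +-cancelˡ-≡ z z (y + t) (begin
    z + z        ≡⟨ sym x+y≡z+z ⟩
    x + y        ≡⟨ cong (_+ y) x≡z+t ⟩
    z + t + y    ≡⟨ +-assoc z t y ⟩
    z + (t + y)  ≡⟨ cong (z +_) (+-comm t y) ⟩
    z + (y + t)  ∎)
  x≡y+t+t : x ≡ y + t + t
  x≡y+t+t = trans x≡z+t (cong (_+ t) z≡y+t)

midpoint-sq : ∀ {x y z} → x + y ≡ z + z →
              ∃[ t ] (x * x + y * y ≡ (z * z + z * z) + (t * t + t * t) × (t ≡ 0 → x ≡ z))
midpoint-sq {x} {y} {z} x+y≡z+z with ≤-total z x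
... | inj₁ z≤x with midpoint-offset x+y≡z+z z≤x
...   | t , refl , refl = t , solve (y ∷ t ∷ []) , λ { refl → +-identityʳ (y + 0) }
midpoint-sq {x} {y} {z} x+y≡z+z | inj₂ x≤z
  with midpoint-offset (trans (+-comm y x) x+y≡z+z) (≮⇒≥ λ y<z → <-irrefl x+y≡z+z (+-mono-≤-< x≤z y<z))
...   | t , refl , refl = t , solve (x ∷ t ∷ []) , λ { refl → sym (+-identityʳ x) }

midpoint-sq-≤ : ∀ {x y z} → x + y ≡ z + z → z * z + z * z ≤ x * x + y * y
midpoint-sq-≤ {x} {y} {z} x+y≡z+z with midpoint-sq {x} {y} {z} x+y≡z+z
... | _ , eq , _ = ≤-trans (m≤m+n _ _) (≤-reflexive (sym eq))

midpoint-sq-≡ : ∀ {x y z} → x + y ≡ z + z → x * x + y * y ≡ z * z + z * z → x ≡ z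
midpoint-sq-≡ {x} {y} {z} x+y≡z+z sq-eq with midpoint-sq {x} {y} {z} x+y≡z+z
... | zero  , _  , t≡0⇒x≡z = t≡0⇒x≡z refl
... | suc _ , eq , _ with +-cancelˡ-≡ (z * z + z * z) _ 0 (trans (sym eq) (trans sq-eq (sym (+-identityʳ _))))
...   | ()

+-≡⇒componentwise-≡ : ∀ {a b c d} → a ≤ b → c ≤ d → a + c ≡ b + d → a ≡ b × c ≡ d
+-≡⇒componentwise-≡ {a} {b} {c} {d} a≤b c≤d a+c≡b+d with m≤n⇒m<n∨m≡n a≤b
... | inj₂ a≡b = a≡b , +-cancelˡ-≡ a c d (trans a+c≡b+d (cong (_+ d) (sym a≡b)))
... | inj₁ a<b = ⊥-elim (<-irrefl a+c≡b+d (+-mono-<-≤ a<b c≤d))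

sumSq : ∀ {s} → (Fin s → ℕ) → ℕ
sumSq {zero}  x = 0
sumSq {suc s} x = x 0F * x 0F + sumSq (x ∘ suc)

sumSq-midpoint-≤ : ∀ {s} {x y z : Fin s → ℕ} → (∀ t → x t + y t ≡ z t + z t) →
                   sumSq z + sumSq z ≤ sumSq x + sumSq y
sumSq-midpoint-≤ {zero}          _   = z≤n
sumSq-midpoint-≤ {suc s} {x} {y} {z} mid = begin
  (z 0F * z 0F + sumSq (z ∘ suc)) + (z 0F * z 0F + sumSq (z ∘ suc))
    ≡⟨ +-interchange (z 0F * z 0F) _ _ _ ⟩
  (z 0F * z 0F + z 0F * z 0F) + (sumSq (z ∘ suc) + sumSq (z ∘ suc))
    ≤⟨ +-mono-≤ (midpoint-sq-≤ {x 0F} {y 0F} {z 0F} (mid 0F))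
                (sumSq-midpoint-≤ {x = x ∘ suc} {y ∘ suc} {z ∘ suc} (mid ∘ suc)) ⟩
  (x 0F * x 0F + y 0F * y 0F) + (sumSq (x ∘ suc) + sumSq (y ∘ suc))
    ≡⟨ +-interchange (x 0F * x 0F) _ _ _ ⟩
  (x 0F * x 0F + sumSq (x ∘ suc)) + (y 0F * y 0F + sumSq (y ∘ suc)) ∎
  where open ≤-Reasoning

sumSq-midpoint-≡ : ∀ {s} {x y z : Fin s → ℕ} → (∀ t → x t + y t ≡ z t + z t) →
                   sumSq x + sumSq y ≡ sumSq z + sumSq z → x ≗ z
sumSq-midpoint-≡ {zero} _ _ ()
sumSq-midpoint-≡ {suc s} {x} {y} {z} mid sq-eq
  with head-eq , tail-eq ← +-≡⇒componentwise-≡ (midpoint-sq-≤ {x 0F} {y 0F} {z 0F} (mid 0F))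
         (sumSq-midpoint-≤ {x = x ∘ suc} {y ∘ suc} {z ∘ suc} (mid ∘ suc))
         (trans (+-interchange (z 0F * z 0F) _ _ _) (trans (sym sq-eq) (+-interchange (x 0F * x 0F) _ _ _)))
  = λ { 0F → midpoint-sq-≡ {x 0F} {y 0F} (mid 0F) (sym head-eq)
    ; (suc t) → sumSq-midpoint-≡ {x = x ∘ suc} {y ∘ suc} (mid ∘ suc) (sym tail-eq) t }

sphere-midpoint : ∀ {s R} {x y z : Fin s → ℕ} → sumSq x ≡ R → sumSq y ≡ R → sumSq z ≡ R →
                  (∀ t → x t + y t ≡ z t + z t) → x ≗ z
sphere-midpoint x∈S y∈S z∈S mid = sumSq-midpoint-≡ mid (cong₂ _+_ (trans x∈S (sym z∈S)) (trans y∈S (sym z∈S)))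

-- A criterion for three-row perfect hash families

-- Rows 0, 1, 2 collide along the sides ij, ik, jk of a triangle of columns. The degenerate
-- triangles k = j, k = i and j = i say that any two rows separate distinct columns.
TriangleFree : ∀ {n q} → Matrix 3 n q → Set
TriangleFree M = ∀ {i j k} → M 0F i ≡ M 0F j → M 1F i ≡ M 1F k → M 2F j ≡ M 2F k → j ≡ i × k ≡ i

opposite : ∀ {o x y : Fin 3} → o ≢ x → o ≢ y → x ≢ y →
           (x , y) ≡ (punchIn o 0F , punchIn o 1F) ⊎ (y , x) ≡ (punchIn o 0F , punchIn o 1F)
opposite o≢x o≢y x≢y with punchOut o≢x | punchIn-punchOut o≢x | punchOut o≢y | punchIn-punchOut o≢y
... | 0F | refl | 0F | refl = ⊥-elim (x≢y refl)
... | 0F | refl | 1F | refl = inj₁ refl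
... | 1F | refl | 0F | refl = inj₂ refl
... | 1F | refl | 1F | refl = ⊥-elim (x≢y refl)

third : ∀ {x y : Fin 3} → x ≢ y → ∃[ o ] (o ≢ x × o ≢ y)
third {x} x≢y with punchOut x≢y | punchIn-punchOut x≢y
... | 0F | refl = punchIn x 1F , punchInᵢ≢i x 1F , (λ ()) ∘ punchIn-injective x 1F 0F
... | 1F | refl = punchIn x 0F , punchInᵢ≢i x 0F , (λ ()) ∘ punchIn-injective x 0F 1F

-- A pair of distinct points of Fin 3 is encoded by the point it misses.
Collides : ∀ {B : Set} → (Fin 3 → B) → Fin 3 → Set
Collides g o = g (punchIn o 0F) ≡ g (punchIn o 1F)

collides⇔ : ∀ {B : Set} {g : Fin 3 → B} {o x y} → o ≢ x → o ≢ y → x ≢ y → Collides g o ⇔ (g x ≡ g y)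
collides⇔ o≢x o≢y x≢y with opposite o≢x o≢y x≢y
... | inj₁ refl = mk⇔ id id
... | inj₂ refl = mk⇔ sym sym

injective-or-collides : ∀ {B : Set} → DecidableEquality B → (g : Fin 3 → B) →
                        Injective _≡_ _≡_ g ⊎ ∃ (Collides g)
injective-or-collides _≟_ g with any? (λ o → g (punchIn o 0F) ≟ g (punchIn o 1F))
... | yes collision = inj₂ collision
... | no  none      = inj₁ λ {x} {y} gx≡gy → decidable-stable (x ≟ᶠ y) λ x≢y →
  let o , o≢x , o≢y = third x≢y in none (o , Equivalence.from (collides⇔ o≢x o≢y x≢y) gx≡gy)

module _ {n q} {M : Matrix 3 n q} (triangle-free : TriangleFree M)
         {cols : Fin 3 → Fin n} (cols-injective : Injective _≡_ _≡_ cols) where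

  private
    row : Fin 3 → Fin 3 → Fin q
    row r i = M r (cols i)

    opposite-columns-differ : ∀ o → cols (punchIn o 1F) ≢ cols (punchIn o 0F)
    opposite-columns-differ o = (λ ()) ∘ punchIn-injective o 1F 0F ∘ cols-injective

  three-collisions-impossible : ∀ {o₀ o₁ o₂} →
                                Collides (row 0F) o₀ → Collides (row 1F) o₁ → Collides (row 2F) o₂ → ⊥
  -- Two rows colliding on the same pair is a degenerate triangle; otherwise the missing
  -- points are distinct and the triangle is i = o₂, j = o₁, k = o₀.
  three-collisions-impossible {o₀} {o₁} {o₂} c₀ c₁ c₂ with o₀ ≟ᶠ o₁ | o₀ ≟ᶠ o₂ | o₁ ≟ᶠ o₂
  ... | yes refl | _        | _        = opposite-columns-differ o₀ (proj₁ (triangle-free c₀ c₁ refl))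
  ... | no _     | yes refl | _        = opposite-columns-differ o₀ (proj₁ (triangle-free c₀ refl (sym c₂)))
  ... | no _     | no _     | yes refl = opposite-columns-differ o₁ (proj₂ (triangle-free refl c₁ c₂))
  ... | no o₀≢o₁ | no o₀≢o₂ | no o₁≢o₂ = o₁≢o₂ (cols-injective (proj₁ (triangle-free e₀ e₁ e₂)))
    where
    e₀ = Equivalence.to (collides⇔ o₀≢o₂ o₀≢o₁ (≢-sym o₁≢o₂)) c₀
    e₁ = Equivalence.to (collides⇔ o₁≢o₂ (≢-sym o₀≢o₁) (≢-sym o₀≢o₂)) c₁
    e₂ = Equivalence.to (collides⇔ (≢-sym o₁≢o₂) (≢-sym o₀≢o₂) (≢-sym o₀≢o₁)) c₂

  some-row-injective : ∃[ r ] Injective _≡_ _≡_ (row r)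
  some-row-injective with injective-or-collides _≟ᶠ_ (row 0F) | injective-or-collides _≟ᶠ_ (row 1F)
                        | injective-or-collides _≟ᶠ_ (row 2F)
  ... | inj₁ injective | _              | _              = 0F , injective
  ... | inj₂ _         | inj₁ injective | _              = 1F , injective
  ... | inj₂ _         | inj₂ _         | inj₁ injective = 2F , injective
  ... | inj₂ (_ , c₀)  | inj₂ (_ , c₁)  | inj₂ (_ , c₂)  = ⊥-elim (three-collisions-impossible c₀ c₁ c₂)

triangleFree⇒isPHF : ∀ {n q} (M : Matrix 3 n q) → TriangleFree M → IsPHF 3 n q 3 M
triangleFree⇒isPHF M triangle-free cols cols-injective = some-row-injective {M = M} triangle-free cols-injective

-- Pigeonhole on fibres

module _ {A : Set} (f : A → ℕ) where

  fibre? : ∀ R → Decidable (λ x → f x ≡ R)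
  fibre? R x = f x ≟ R

  below? : ∀ B → Decidable (λ x → f x < B)
  below? B x = f x <? B

  fibre below : ℕ → List A → List A
  fibre R = filter (fibre? R)
  below B = filter (below? B)

  length-below-suc : ∀ B xs → length (below (suc B) xs) ≡ length (fibre B xs) + length (below B xs)
  length-below-suc B [] = refl
  length-below-suc B (x ∷ xs) with <-cmp (f x) B
  ... | tri< fx<B fx≢B _ = begin
    length (below (suc B) (x ∷ xs))                   ≡⟨ cong length (filter-accept (below? (suc B)) (m<n⇒m<1+n fx<B)) ⟩
    suc (length (below (suc B) xs))                   ≡⟨ cong suc (length-below-suc B xs) ⟩
    suc (length (fibre B xs) + length (below B xs))   ≡⟨ +-suc _ _ ⟨
    length (fibre B xs) + suc (length (below B xs))   ≡⟨ cong₂ _+_ (cong length (filter-reject (fibre? B) fx≢B))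
                                                                    (cong length (filter-accept (below? B) fx<B)) ⟨
    length (fibre B (x ∷ xs)) + length (below B (x ∷ xs)) ∎
    where open ≡-Reasoning
  ... | tri≈ fx≮B fx≡B _ = begin
    length (below (suc B) (x ∷ xs))                   ≡⟨ cong length (filter-accept (below? (suc B)) (s≤s (≤-reflexive fx≡B))) ⟩
    suc (length (below (suc B) xs))                   ≡⟨ cong suc (length-below-suc B xs) ⟩
    suc (length (fibre B xs) + length (below B xs))   ≡⟨ cong₂ _+_ (cong length (filter-accept (fibre? B) fx≡B))
                                                                    (cong length (filter-reject (below? B) fx≮B)) ⟨
    length (fibre B (x ∷ xs)) + length (below B (x ∷ xs)) ∎
    where open ≡-Reasoning
  ... | tri> _ fx≢B fx>B = begin
    length (below (suc B) (x ∷ xs))                   ≡⟨ cong length (filter-reject (below? (suc B)) (<⇒≱ fx>B ∘ s≤s⁻¹)) ⟩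
    length (below (suc B) xs)                         ≡⟨ length-below-suc B xs ⟩
    length (fibre B xs) + length (below B xs)         ≡⟨ cong₂ _+_ (cong length (filter-reject (fibre? B) fx≢B))
                                                                    (cong length (filter-reject (below? B) (<⇒≯ fx>B))) ⟨
    length (fibre B (x ∷ xs)) + length (below B (x ∷ xs)) ∎
    where open ≡-Reasoning

  pigeonhole-below : ∀ B xs → ∃[ R ] length (below B xs) ≤ B * length (fibre R xs)
  pigeonhole-below zero xs =
    0 , ≤-reflexive (cong length (filter-none (below? 0) (All.universal (λ _ ()) xs)))
  pigeonhole-below (suc B) xs with pigeonhole-below B xs
  ... | R , ih with length (fibre R xs) ≤? length (fibre B xs)
  ... | yes R≤B = B , (begin
    length (below (suc B) xs)                      ≡⟨ length-below-suc B xs ⟩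
    length (fibre B xs) + length (below B xs)      ≤⟨ +-monoʳ-≤ (length (fibre B xs)) (≤-trans ih (*-monoʳ-≤ B R≤B)) ⟩
    length (fibre B xs) + B * length (fibre B xs)  ∎)
    where open ≤-Reasoning
  ... | no R≰B = R , (begin
    length (below (suc B) xs)                      ≡⟨ length-below-suc B xs ⟩
    length (fibre B xs) + length (below B xs)      ≤⟨ +-mono-≤ (<⇒≤ (≰⇒> R≰B)) ih ⟩
    length (fibre R xs) + B * length (fibre R xs)  ∎)
    where open ≤-Reasoning

  pigeonhole-fibre : ∀ B xs → All (λ x → f x < B) xs → ∃[ R ] length xs ≤ B * length (fibre R xs)
  pigeonhole-fibre B xs all<B with R , bound ← pigeonhole-below B xs =
    R , subst (λ ys → length ys ≤ B * length (fibre R xs)) (filter-all (below? B) all<B) bound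

funToFin-cong : ∀ {m n} {f g : Fin m → Fin n} → f ≗ g → funToFin f ≡ funToFin g
funToFin-cong {zero}  _   = refl
funToFin-cong {suc m} f≗g = cong₂ combine (f≗g 0F) (funToFin-cong (f≗g ∘ suc))

finToFun-injective : ∀ {m n} {i j : Fin (m ^ n)} → finToFun {m} {n} i ≗ finToFun j → i ≡ j
finToFun-injective {m} {n} {i} {j} eq = begin
  i                             ≡⟨ funToFin-finToFin {n} {m} i ⟨
  funToFin (finToFun {m} {n} i) ≡⟨ funToFin-cong eq ⟩
  funToFin (finToFun {m} {n} j) ≡⟨ funToFin-finToFin {n} {m} j ⟩
  j                             ∎
  where open ≡-Reasoning

digits : ∀ {b s} → Fin (b ^ s) → Fin s → ℕ
digits {b} {s} i = toℕ ∘ finToFun {b} {s} i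

digits-< : ∀ {b s} (i : Fin (b ^ s)) t → digits {b} {s} i t < b
digits-< {b} {s} i t = toℕ<n (finToFun {b} {s} i t)

digits-injective : ∀ {b s} {i j : Fin (b ^ s)} → digits {b} {s} i ≗ digits j → i ≡ j
digits-injective {b} {s} eq = finToFun-injective {b} {s} (toℕ-injective ∘ eq)

fromDigits : ∀ {b s} (x : Fin s → ℕ) → (∀ t → x t < b) → Fin (b ^ s)
fromDigits x x<b = funToFin (λ t → fromℕ< (x<b t))

digits-fromDigits : ∀ {b s} {x : Fin s → ℕ} (x<b : ∀ t → x t < b) → digits {b} {s} (fromDigits x x<b) ≗ x
digits-fromDigits {b} {s} x<b t = trans (cong toℕ (finToFun-funToFin {s} {b} _ t)) (toℕ-fromℕ< (x<b t))

fromDigits-injective : ∀ {b s} {x y : Fin s → ℕ} (x<b : ∀ t → x t < b) (y<b : ∀ t → y t < b) →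
                       fromDigits x x<b ≡ fromDigits y y<b → x ≗ y
fromDigits-injective {b} {s} x<b y<b eq t =
  trans (sym (digits-fromDigits x<b t)) (trans (cong (λ i → digits {b} {s} i t) eq) (digits-fromDigits y<b t))

remQuot-injective : ∀ {m} n {i j : Fin (m * n)} → remQuot {m} n i ≡ remQuot n j → i ≡ j
remQuot-injective {m} n {i} {j} eq =
  trans (sym (combine-remQuot {m} n i)) (trans (cong (uncurry combine) eq) (combine-remQuot {m} n j))

lookup-injective : ∀ {A : Set} {xs : List A} → Unique xs → ∀ {i j} → lookup xs i ≡ lookup xs j → i ≡ j
lookup-injective (_   ∷ _) {zero}  {zero}  _  = refl
lookup-injective (x≢_ ∷ _) {zero}  {suc j} eq = ⊥-elim (All.lookup x≢_ (∈-lookup j) eq)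
lookup-injective (x≢_ ∷ _) {suc i} {zero}  eq = ⊥-elim (All.lookup x≢_ (∈-lookup i) (sym eq))
lookup-injective (_   ∷ u) {suc i} {suc j} eq = cong suc (lookup-injective u eq)

sumSq-≤ : ∀ {s d} {x : Fin s → ℕ} → (∀ t → x t < d) → sumSq x ≤ s * (d * d)
sumSq-≤ {zero}  _   = z≤n
sumSq-≤ {suc s} x<d = +-mono-≤ (*-mono-≤ (<⇒≤ (x<d 0F)) (<⇒≤ (x<d 0F))) (sumSq-≤ (x<d ∘ suc))

form : Fin 3 → ℕ → ℕ → ℕ
form 0F u a = u + a
form 1F u a = u
form 2F u a = u + u + a

form-< : ∀ r {d u a} → u < d → a < d → form r u a < 3 * d
form-< 0F {d} u<d a<d = ≤-trans (+-mono-< u<d a<d) (+-monoʳ-≤ d (m≤m+n d (d + 0)))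
form-< 1F {d} u<d a<d = ≤-trans u<d (m≤m+n d (d + (d + 0)))
form-< 2F {d} u<d a<d = ≤-trans (+-mono-≤-< (+-mono-≤ (<⇒≤ u<d) (<⇒≤ u<d)) a<d) (≤-reflexive (solve (d ∷ [])))

form-triangle : ∀ {uᵢ aᵢ uⱼ aⱼ uₖ aₖ} → form 0F uᵢ aᵢ ≡ form 0F uⱼ aⱼ → form 1F uᵢ aᵢ ≡ form 1F uₖ aₖ →
                form 2F uⱼ aⱼ ≡ form 2F uₖ aₖ → aⱼ + aₖ ≡ aᵢ + aᵢ
form-triangle {uᵢ} {aᵢ} {uⱼ} {aⱼ} {_} {aₖ} e₀ refl e₂ = +-cancelʳ-≡ (uᵢ + uᵢ) _ _ (begin
  aⱼ + aₖ + (uᵢ + uᵢ)      ≡⟨ solve (aⱼ ∷ aₖ ∷ uᵢ ∷ []) ⟩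
  aⱼ + (uᵢ + uᵢ + aₖ)      ≡⟨ cong (aⱼ +_) (sym e₂) ⟩
  aⱼ + (uⱼ + uⱼ + aⱼ)      ≡⟨ solve (aⱼ ∷ uⱼ ∷ []) ⟩
  (uⱼ + aⱼ) + (uⱼ + aⱼ)    ≡⟨ cong₂ _+_ (sym e₀) (sym e₀) ⟩
  (uᵢ + aᵢ) + (uᵢ + aᵢ)    ≡⟨ solve (uᵢ ∷ aᵢ ∷ []) ⟩
  aᵢ + aᵢ + (uᵢ + uᵢ)      ∎)
  where open ≡-Reasoning

module Behrend (q d s : ℕ) (3d^s≤q : (3 * d) ^ s ≤ q) (R : ℕ) where

  point : Fin (d ^ s) → Fin s → ℕ
  point = digits {d} {s}

  sphere : List (Fin (d ^ s))
  sphere = fibre (sumSq ∘ point) R (allFin (d ^ s))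

  m : ℕ
  m = length sphere

  position : Fin (d ^ s * m) → Fin (d ^ s) × Fin m
  position = remQuot {d ^ s} m

  U A : Fin (d ^ s * m) → Fin s → ℕ
  U c = point (proj₁ (position c))
  A c = point (lookup sphere (proj₂ (position c)))

  entry : Fin 3 → Fin (d ^ s * m) → Fin s → ℕ
  entry r c t = form r (U c t) (A c t)

  entry-< : ∀ r c t → entry r c t < 3 * d
  entry-< r c t = form-< r (digits-< {d} {s} _ t) (digits-< {d} {s} _ t)

  matrix : Matrix 3 (d ^ s * m) q
  matrix r c = inject≤ (fromDigits (entry r c) (entry-< r c)) 3d^s≤q

  matrix-≡ : ∀ r {c c′} → matrix r c ≡ matrix r c′ → entry r c ≗ entry r c′
  matrix-≡ r eq = fromDigits-injective {3 * d} {s} (entry-< r _) (entry-< r _) (inject≤-injective _ _ _ _ eq)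

  column-injective : ∀ {c c′} → U c ≗ U c′ → A c ≗ A c′ → c ≡ c′
  column-injective U≗ A≗ = remQuot-injective {d ^ s} m (cong₂ _,_ (digits-injective {d} {s} U≗)
    (lookup-injective (filter⁺ (fibre? (sumSq ∘ point) R) (allFin⁺ (d ^ s))) (digits-injective {d} {s} A≗)))

  A-on-sphere : ∀ c → sumSq (A c) ≡ R
  A-on-sphere c = All.lookup (all-filter (fibre? (sumSq ∘ point) R) (allFin (d ^ s))) (∈-lookup (proj₂ (position c)))

  triangleFree : TriangleFree matrix
  triangleFree {i} {j} {k} e₀ e₁ e₂ = column-injective Uⱼ≗Uᵢ Aⱼ≗Aᵢ , column-injective Uₖ≗Uᵢ Aₖ≗Aᵢ
    where
    midpoint : ∀ t → A j t + A k t ≡ A i t + A i t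
    midpoint t = form-triangle (matrix-≡ 0F e₀ t) (matrix-≡ 1F e₁ t) (matrix-≡ 2F e₂ t)
    Aⱼ≗Aᵢ : A j ≗ A i
    Aⱼ≗Aᵢ = sphere-midpoint (A-on-sphere j) (A-on-sphere k) (A-on-sphere i) midpoint
    Aₖ≗Aᵢ : A k ≗ A i
    Aₖ≗Aᵢ = sphere-midpoint (A-on-sphere k) (A-on-sphere j) (A-on-sphere i)
                            (λ t → trans (+-comm (A k t) _) (midpoint t))
    Uⱼ≗Uᵢ : U j ≗ U i
    Uⱼ≗Uᵢ t = +-cancelʳ-≡ (A i t) _ _ (trans (cong (U j t +_) (sym (Aⱼ≗Aᵢ t))) (sym (matrix-≡ 0F e₀ t)))
    Uₖ≗Uᵢ : U k ≗ U i
    Uₖ≗Uᵢ t = sym (matrix-≡ 1F e₁ t)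

behrend : ∀ q d s → (3 * d) ^ s ≤ q → ∃[ m ] ∃[ M ] (IsPHF 3 (d ^ s * m) q 3 M × d ^ s ≤ suc (s * (d * d)) * m)
behrend q d s 3d^s≤q
  with R , bound ← pigeonhole-fibre (sumSq ∘ digits {d} {s}) (suc (s * (d * d))) (allFin (d ^ s))
                     (tabulate⁺ λ i → s≤s (sumSq-≤ (digits-< {d} {s} i)))
  = m , matrix , triangleFree⇒isPHF matrix triangleFree ,
    subst (_≤ suc (s * (d * d)) * m) (length-tabulate {n = d ^ s} id) bound
  where open Behrend q d s 3d^s≤q R

-- Choice of parameters

identity-isPHF : ∀ {N n t} → IsPHF (suc N) n n t (λ _ j → j)
identity-isPHF cols cols-injective = 0F , cols-injective

identity-bound : ∀ {q s} → 1 ≤ q → q < 3 ^ s → q * q < q * 2 ^ (11 * s)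
identity-bound {q} {s} 1≤q q<3^s = *-monoʳ-< q {{>-nonZero 1≤q}} (begin-strict
  q             <⟨ q<3^s ⟩
  3 ^ s         ≤⟨ ^-monoˡ-≤ s (m≤m+n 3 2045) ⟩
  (2 ^ 11) ^ s  ≡⟨ ^-*-assoc 2 11 s ⟩
  2 ^ (11 * s)  ∎)
  where open ≤-Reasoning

crossing : ∀ (g : ℕ → ℕ) {q} a k → g a ≤ q → q < g (a + k) → ∃[ d ] (a ≤ d × g d ≤ q × q < g (suc d))
crossing g a zero ga≤q q<ga rewrite +-identityʳ a = ⊥-elim (<⇒≱ q<ga ga≤q)
crossing g {q} a (suc k) ga≤q q<g[a+1+k] with g (suc a) ≤? q
... | no  g[1+a]≰q = a , ≤-refl , ga≤q , ≰⇒> g[1+a]≰q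
... | yes g[1+a]≤q with d , a<d , found ← crossing g (suc a) k g[1+a]≤q (subst (λ x → q < g x) (+-suc a k) q<g[a+1+k])
  = d , <⇒≤ a<d , found

^-distribʳ-* : ∀ m n o → (m * n) ^ o ≡ m ^ o * n ^ o
^-distribʳ-* m n zero    = refl
^-distribʳ-* m n (suc o) = trans (cong (m * n *_) (^-distribʳ-* m n o)) (*-interchange m n (m ^ o) (n ^ o))

m≤m^n : ∀ m n → 1 ≤ m → 1 ≤ n → m ≤ m ^ n
m≤m^n m (suc n) 1≤m _ = begin
  m          ≡⟨ *-identityʳ m ⟨
  m * 1      ≡⟨ cong (m *_) (^-zeroˡ n) ⟨
  m * 1 ^ n  ≤⟨ *-monoʳ-≤ m (^-monoˡ-≤ n 1≤m) ⟩
  m * m ^ n  ∎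
  where open ≤-Reasoning

n<2^n : ∀ n → n < 2 ^ n
n<2^n zero    = s≤s z≤n
n<2^n (suc n) = ≤-trans (≤-reflexive (+-comm 1 (suc n))) (+-mono-≤ (n<2^n n) (≤-trans (m^n>0 2 n) (m≤m+n _ 0)))

n<2^suc⌊log₂n⌋ : ∀ n → n < 2 ^ suc ⌊log₂ n ⌋
n<2^suc⌊log₂n⌋ n = ≰⇒> λ 2^suc⌊log₂n⌋≤n →
  1+n≰n (≤-trans (≤-reflexive (sym (⌊log₂[2^n]⌋≡n (suc ⌊log₂ n ⌋)))) (⌊log₂⌋-mono-≤ 2^suc⌊log₂n⌋≤n))

⌊log₂n⌋≤m*m⇒1≤m : ∀ {n m} → 2 ≤ n → ⌊log₂ n ⌋ ≤ m * m → 1 ≤ m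
⌊log₂n⌋≤m*m⇒1≤m {m = zero}  2≤q log≤0 = ⊥-elim (1+n≰n (≤-trans (⌊log₂⌋-mono-≤ 2≤q) log≤0))
⌊log₂n⌋≤m*m⇒1≤m {m = suc _} _ _ = s≤s z≤n

n<[3+3n]^m : ∀ n m → 1 ≤ m → n < (3 * suc n) ^ m
n<[3+3n]^m n m 1≤m = ≤-trans (≤-trans (n<1+n n) (m≤n*m (suc n) 3)) (m≤m^n (3 * suc n) m (s≤s z≤n) 1≤m)

suc[m*n]≤suc[m]*suc[n] : ∀ m n → suc (m * n) ≤ suc m * suc n
suc[m*n]≤suc[m]*suc[n] m n = s≤s (≤-trans (*-monoʳ-≤ m (n≤1+n n)) (m≤n+m (m * suc n) n))

module _ {q s d : ℕ} (1≤s : 1 ≤ s) (1≤d : 1 ≤ d) (log≤s² : ⌊log₂ q ⌋ ≤ s * s)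
         (3d^s≤q : (3 * d) ^ s ≤ q) (q<[3+3d]^s : q < (3 * suc d) ^ s) where

  private
    d^s≤q : d ^ s ≤ q
    d^s≤q = ≤-trans (^-monoˡ-≤ s (m≤n*m d 3)) 3d^s≤q

    q<6^s*d^s : q < 6 ^ s * d ^ s
    q<6^s*d^s = begin-strict
      q                <⟨ q<[3+3d]^s ⟩
      (3 * suc d) ^ s  ≤⟨ ^-monoˡ-≤ s 3[1+d]≤6d ⟩
      (6 * d) ^ s      ≡⟨ ^-distribʳ-* 6 d s ⟩
      6 ^ s * d ^ s    ∎
      where
      open ≤-Reasoning
      3[1+d]≤6d : 3 * suc d ≤ 6 * d
      3[1+d]≤6d = begin
        3 * suc d      ≡⟨ solve (d ∷ []) ⟩
        3 + 3 * d      ≤⟨ +-monoˡ-≤ (3 * d) (*-monoʳ-≤ 3 1≤d) ⟩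
        3 * d + 3 * d  ≡⟨ solve (d ∷ []) ⟩
        6 * d          ∎

    q<[4^s]^s : q < (4 ^ s) ^ s
    q<[4^s]^s = begin-strict
      q                          <⟨ n<2^suc⌊log₂n⌋ q ⟩
      2 ^ suc ⌊log₂ q ⌋          ≤⟨ ^-monoʳ-≤ 2 (s≤s log≤s²) ⟩
      2 ^ suc (s * s)            ≤⟨ ^-monoʳ-≤ 2 (+-monoˡ-≤ (s * s) (*-mono-≤ 1≤s 1≤s)) ⟩
      2 ^ (s * s + s * s)        ≡⟨ ^-distribˡ-+-* 2 (s * s) (s * s) ⟩
      2 ^ (s * s) * 2 ^ (s * s)  ≡⟨ ^-distribʳ-* 2 2 (s * s) ⟨
      4 ^ (s * s)                ≡⟨ ^-*-assoc 4 s s ⟨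
      (4 ^ s) ^ s                ∎
      where open ≤-Reasoning

    d<4^s : d < 4 ^ s
    d<4^s = ≰⇒> λ 4^s≤d → <⇒≱ q<[4^s]^s (≤-trans (^-monoˡ-≤ s 4^s≤d) d^s≤q)

    1+s*d²≤32^s : suc (s * (d * d)) ≤ 32 ^ s
    1+s*d²≤32^s = begin
      suc (s * (d * d))      ≤⟨ suc[m*n]≤suc[m]*suc[n] s (d * d) ⟩
      suc s * suc (d * d)    ≤⟨ *-mono-≤ (n<2^n s) (*-mono-< d<4^s d<4^s) ⟩
      2 ^ s * (4 ^ s * 4 ^ s) ≡⟨ cong (2 ^ s *_) (^-distribʳ-* 4 4 s) ⟨
      2 ^ s * 16 ^ s         ≡⟨ ^-distribʳ-* 2 16 s ⟨
      32 ^ s                 ∎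
      where open ≤-Reasoning

  behrend-bound : ∀ m → d ^ s ≤ suc (s * (d * d)) * m → q * q < d ^ s * m * 2 ^ (11 * s)
  behrend-bound m d^s≤Bm = begin-strict
    q * q                                              <⟨ *-mono-< q<6^s*d^s q<6^s*d^s ⟩
    (6 ^ s * d ^ s) * (6 ^ s * d ^ s)                  ≡⟨ *-interchange (6 ^ s) (d ^ s) (6 ^ s) (d ^ s) ⟩
    (6 ^ s * 6 ^ s) * (d ^ s * d ^ s)                  ≤⟨ *-monoʳ-≤ (6 ^ s * 6 ^ s) (*-monoʳ-≤ (d ^ s) d^s≤Bm) ⟩
    (6 ^ s * 6 ^ s) * (d ^ s * (suc (s * (d * d)) * m)) ≡⟨ regroup (6 ^ s * 6 ^ s) (d ^ s) (suc (s * (d * d))) m ⟩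
    (6 ^ s * 6 ^ s * suc (s * (d * d))) * (d ^ s * m)  ≤⟨ *-monoˡ-≤ (d ^ s * m) (*-monoʳ-≤ (6 ^ s * 6 ^ s) 1+s*d²≤32^s) ⟩
    (6 ^ s * 6 ^ s * 32 ^ s) * (d ^ s * m)             ≡⟨ cong (λ x → x * 32 ^ s * (d ^ s * m)) (^-distribʳ-* 6 6 s) ⟨
    (36 ^ s * 32 ^ s) * (d ^ s * m)                    ≡⟨ cong (_* (d ^ s * m)) (^-distribʳ-* 36 32 s) ⟨
    1152 ^ s * (d ^ s * m)                             ≤⟨ *-monoˡ-≤ (d ^ s * m) (^-monoˡ-≤ s (m≤m+n 1152 896)) ⟩
    (2 ^ 11) ^ s * (d ^ s * m)                         ≡⟨ cong (_* (d ^ s * m)) (^-*-assoc 2 11 s) ⟩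
    2 ^ (11 * s) * (d ^ s * m)                         ≡⟨ *-comm (2 ^ (11 * s)) (d ^ s * m) ⟩
    d ^ s * m * 2 ^ (11 * s)                           ∎
    where
    open ≤-Reasoning
    regroup : ∀ a b c e → a * (b * (c * e)) ≡ a * c * (b * e)
    regroup = solve-∀

theorem5p6 : ∃[ C ] ((q : ℕ) → 3 ≤ q → (s : ℕ) → ⌊log₂ q ⌋ ≤ s * s →
               ∃[ n ] ∃[ M ] (IsPHF 3 n q 3 M × q * q < n * 2 ^ (C * s)))
theorem5p6 = 11 , construction
  where
  construction : (q : ℕ) → 3 ≤ q → (s : ℕ) → ⌊log₂ q ⌋ ≤ s * s →
                 ∃[ n ] ∃[ M ] (IsPHF 3 n q 3 M × q * q < n * 2 ^ (11 * s))
  construction q 3≤q s log≤s² with q <? 3 ^ s | ⌊log₂n⌋≤m*m⇒1≤m (<⇒≤ 3≤q) log≤s²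
  ... | yes q<3^s | _ = q , (λ _ j → j) , identity-isPHF , identity-bound {s = s} (≤-trans (s≤s z≤n) 3≤q) q<3^s
  ... | no q≮3^s | 1≤s =
    let d , 1≤d , 3d^s≤q , q<[3+3d]^s = crossing (λ d → (3 * d) ^ s) 1 q (≮⇒≥ q≮3^s) (n<[3+3n]^m q s 1≤s)
        m , M , isPHF , d^s≤Bm        = behrend q d s 3d^s≤q
    in  d ^ s * m , M , isPHF , behrend-bound 1≤s 1≤d log≤s² 3d^s≤q q<[3+3d]^s m d^s≤Bm
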